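{- For an involutive generalized dynamic algebra $\mathfrak K=(K,\bigsqcup,\odot,{}^*,{\sim},e)$ let $\mathscr T(K)$ be the smallest subset of $K$ containing $\widetilde K$ and closed under $e$, $\odot$ and ${}^*$, and for a morphism $f$ of involutive generalized dynamic algebras let $\mathscr T(f)$ be the restriction of $f$. Then: (1) for every such $\mathfrak K$, $\widetilde K\subseteq\mathscr T(K)\subseteq K$ and $\mathscr T(\mathfrak K)=(\mathscr T(K),\odot,{}^*,e)$ is an involutive submonoid of $(K,\odot,{}^*,e)$; (2) if $\mathfrak K$ is a semi-Foulis dynamic algebra such that $s=t\iff s\equiv t$ for all $s,t\in\mathscr T(K)$, then $\nu_{\mathfrak K}(k):=k\bullet(-)$ defines an isomorphism of involutive monoids $\nu_{\mathfrak K}:\mathscr T(\mathfrak K)\to\mathscr T(\mathbf{Lin}(\widetilde{\mathfrak K}))$, where $\widetilde{\mathfrak K}=(\widetilde K,\preceq,{}^\perp)$, whose restriction to $\widetilde K$ is an order-preserving bijection onto the test set $\{\pi_u:u\in\widetilde K\}$ of $\mathbf{Lin}(\widetilde{\mathfrak K})$ (ordered by $p\le q\iff p=q\circ p$); (3) for every complete orthomodular lattice $\mathcal M$, $\mu_{\mathcal M}(f):=\{f\}$ defines an isomorphism of involutive monoids $\mathscr T(\mathbf{Lin}(\mathcal M))\to\mathscr T(\mathscr P(\mathscr T(\mathbf{Lin}(\mathcal M))))$; (4) for every morphism $f:\mathfrak K_1\to\mathfrak K_2$ of involutive generalized dynamic algebras, $f(\mathscr T(K_1))\subseteq\mathscr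 T(K_2)$ and $\mathscr T(f)=f|_{\mathscr T(K_1)}:\mathscr T(\mathfrak K_1)\to\mathscr T(\mathfrak K_2)$.
   Context: A unital involutive quantale $(K,\bigsqcup,\odot,{}^*,e)$: complete join-semilattice (binary join $\sqcup$), associative $\odot$ distributing over arbitrary joins on both sides, unit $e$, involution with $x^{**}=x$, $(x\odot y)^*=y^*\odot x^*$, $(\bigsqcup x_i)^*=\bigsqcup x_i^*$. An involutive generalized dynamic algebra (IDA) is $(K,\bigsqcup,\odot,{}^*,{\sim},e)$ with such a quantale and ${\sim}:K\to K$ satisfying for all $x,y$ and families $(x_i)$: ${\sim}(x\odot{\sim}{\sim}y)={\sim}(x\odot y)$; ${\sim}(\bigsqcup_i{\sim}{\sim}x_i)={\sim}(\bigsqcup_ix_i)$; $({\sim}x)^*={\sim}x$; ${\sim}{\sim}({\sim}{\sim}x\odot y)={\sim}({\sim}x\sqcup{\sim}({\sim}x\sqcup y))$. Notation: $\widetilde K=\{{\sim}k:k\in K\}$ (the test set); $\bigvee W={\sim}{\sim}\bigsqcup W$ for $W\subseteq\widetilde K$; $k\preceq l$ iff $\bigvee\{k,l\}=l$; $w^\perp={\sim}w$; $k\bullet v={\sim}{\sim}(k\odot v)$ for $v\in\widetilde K$; $k\equiv l$ iff $k\bullet w=l\bullet w$ for all $w\in\widetilde K$. IDA morphisms preserve arbitrary joins, $\odot$, unit, ${}^*$, ${\sim}$. A semi-Foulis dynamic algebra is an IDA with $(\widetilde K,\preceq,{}^\perp)$ a complete orthomodular lattice (OML: bounded lattice with $m\wedge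 m^\perp=0$, $m\vee m^\perp=1$, antitone involutive ${}^\perp$, and $m\le n\Rightarrow n=m\vee(m^\perp\wedge n)$). For a complete OML $\mathcal M$, $\pi_m(x)=m\wedge(m^\perp\vee x)$; $\mathbf{Lin}(\mathcal M)$ is the set of maps $f:M\to M$ admitting $f^*:M\to M$ with $f(x)\le y^\perp\iff x\le f^*(y)^\perp$, with pointwise order and joins, $\odot=\circ$, involution $f\mapsto f^*$, unit $\mathrm{id}_M$ and ${\sim}f=\pi_{f(1)^\perp}$; it is an IDA with test set $\{\pi_m:m\in M\}$. For an involutive submonoid $L\subseteq\mathbf{Lin}(\mathcal M)$ containing all $\pi_m$, $\mathscr P(L)$ is the IDA of all subsets of $L$ with union, $A\odot B=\{a\circ b:a\in A,b\in B\}$, $A^*=\{a^*:a\in A\}$, ${\sim}A=\{\pi_{(\bigvee_{a\in A}a(1))^\perp}\}$, unit $\{\mathrm{id}_M\}$. -}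

module Defs where

open import Level using (Level; _⊔_; Lift) renaming (suc to lsuc)
open import Relation.Binary.Core using (Rel)
open import Relation.Binary.Structures using (IsPartialOrder; IsEquivalence)
open import Data.Product using (Σ; Σ-syntax; ∃; _×_; _,_; proj₁; proj₂)
open import Function.Bundles using (_⇔_; mk⇔; Equivalence)

record IsCompleteOML {c ℓ₁ ℓ₂} (ι : Level) (A : Set c)
       (_≈_ : Rel A ℓ₁) (_≤_ : Rel A ℓ₂) (_ᶜ : A → A)
       : Set (lsuc ι ⊔ c ⊔ ℓ₁ ⊔ ℓ₂) where
  field
    isPartialOrder : IsPartialOrder _≈_ _≤_
    ⋁        : {I : Set ι} → (I → A) → A
    ⋁-upper  : ∀ {I : Set ι} (f : I → A) (i : I) → f i ≤ ⋁ f
    ⋁-least  : ∀ {I : Set ι} (f : I → A) (x : A) → (∀ i → f i ≤ x) → ⋁ f ≤ x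
    _∨_      : A → A → A
    ∨-upperˡ : ∀ x y → x ≤ (x ∨ y)
    ∨-upperʳ : ∀ x y → y ≤ (x ∨ y)
    ∨-least  : ∀ x y z → x ≤ z → y ≤ z → (x ∨ y) ≤ z
    _∧_      : A → A → A
    ∧-lowerˡ : ∀ x y → (x ∧ y) ≤ x
    ∧-lowerʳ : ∀ x y → (x ∧ y) ≤ y
    ∧-greatest : ∀ x y z → z ≤ x → z ≤ y → z ≤ (x ∧ y)
    𝟘 𝟙      : A
    𝟘-least  : ∀ x → 𝟘 ≤ x
    𝟙-greatest : ∀ x → x ≤ 𝟙
    ᶜ-antitone  : ∀ {x y} → x ≤ y → (y ᶜ) ≤ (x ᶜ)
    ᶜ-involutive : ∀ x → ((x ᶜ) ᶜ) ≈ x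
    ∧-ᶜ : ∀ x → (x ∧ (x ᶜ)) ≈ 𝟘
    ∨-ᶜ : ∀ x → (x ∨ (x ᶜ)) ≈ 𝟙
    orthomodular : ∀ {m n} → m ≤ n → n ≈ (m ∨ ((m ᶜ) ∧ n))

record CompleteOML (c ℓ₁ ℓ₂ ι : Level) : Set (lsuc (c ⊔ ℓ₁ ⊔ ℓ₂ ⊔ ι)) where
  infix 4 _≈_ _≤_
  field
    Carrier : Set c
    _≈_     : Rel Carrier ℓ₁
    _≤_     : Rel Carrier ℓ₂
    _ᶜ      : Carrier → Carrier
    isCompleteOML : IsCompleteOML ι Carrier _≈_ _≤_ _ᶜ
  open IsCompleteOML isCompleteOML public

record Sig (c ℓ : Level) : Set (lsuc (c ⊔ ℓ)) where
  infix 4 _≈_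
  infixl 7 _⊙_
  field
    Carrier : Set c
    _≈_ : Rel Carrier ℓ
    e   : Carrier
    _⊙_ : Carrier → Carrier → Carrier
    _*  : Carrier → Carrier
    ∼_  : Carrier → Carrier

data 𝒯 {c ℓ} (S : Sig c ℓ) : Sig.Carrier S → Set (c ⊔ ℓ) where
  𝒯-test : ∀ k → 𝒯 S (Sig.∼_ S k)
  𝒯-e    : 𝒯 S (Sig.e S)
  𝒯-⊙    : ∀ {x y} → 𝒯 S x → 𝒯 S y → 𝒯 S (Sig._⊙_ S x y)
  𝒯-*    : ∀ {x} → 𝒯 S x → 𝒯 S (Sig._* S x)
  𝒯-resp : ∀ {x y} → Sig._≈_ S x y → 𝒯 S x → 𝒯 S y

𝒯Elem : ∀ {c ℓ} → Sig c ℓ → Set (c ⊔ ℓ)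
𝒯Elem S = Σ (Sig.Carrier S) (𝒯 S)

IsTest : ∀ {c ℓ} (S : Sig c ℓ) → Sig.Carrier S → Set (c ⊔ ℓ)
IsTest S w = Σ (Sig.Carrier S) λ k → Sig._≈_ S w (Sig.∼_ S k)

record IsInvMonoidHom {c₁ ℓ₁ c₂ ℓ₂} (S₁ : Sig c₁ ℓ₁) (S₂ : Sig c₂ ℓ₂)
       (φ : 𝒯Elem S₁ → 𝒯Elem S₂) : Set (c₁ ⊔ ℓ₁ ⊔ c₂ ⊔ ℓ₂) where
  private
    module A = Sig S₁
    module B = Sig S₂
  field
    φ-cong : ∀ (a b : 𝒯Elem S₁) → proj₁ a A.≈ proj₁ b → proj₁ (φ a) B.≈ proj₁ (φ b)
    φ-e    : ∀ (p : 𝒯 S₁ A.e) → proj₁ (φ (A.e , p)) B.≈ B.e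
    φ-⊙    : ∀ (a b : 𝒯Elem S₁) (p : 𝒯 S₁ (proj₁ a A.⊙ proj₁ b)) →
             proj₁ (φ (proj₁ a A.⊙ proj₁ b , p)) B.≈ (proj₁ (φ a) B.⊙ proj₁ (φ b))
    φ-*    : ∀ (a : 𝒯Elem S₁) (p : 𝒯 S₁ (proj₁ a A.*)) →
             proj₁ (φ (proj₁ a A.* , p)) B.≈ (proj₁ (φ a) B.*)

record IsInvMonoidIso {c₁ ℓ₁ c₂ ℓ₂} (S₁ : Sig c₁ ℓ₁) (S₂ : Sig c₂ ℓ₂)
       (φ : 𝒯Elem S₁ → 𝒯Elem S₂) : Set (c₁ ⊔ ℓ₁ ⊔ c₂ ⊔ ℓ₂) where
  private
    module A = Sig S₁
    module B = Sig S₂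
  field
    isHom      : IsInvMonoidHom S₁ S₂ φ
    injective  : ∀ (a b : 𝒯Elem S₁) → proj₁ (φ a) B.≈ proj₁ (φ b) → proj₁ a A.≈ proj₁ b
    surjective : ∀ (b : 𝒯Elem S₂) → Σ (𝒯Elem S₁) λ a → proj₁ (φ a) B.≈ proj₁ b

record IDA (c ℓ ι : Level) : Set (lsuc (c ⊔ ℓ ⊔ ι)) where
  infix 4 _≈_ _≤_
  infixl 7 _⊙_
  infixl 6 _⊔K_
  field
    Carrier : Set c
    _≈_ : Rel Carrier ℓ
    _≤_ : Rel Carrier ℓ
    isPartialOrder : IsPartialOrder _≈_ _≤_
    ⨆       : {I : Set ι} → (I → Carrier) → Carrier
    ⨆-upper : ∀ {I : Set ι} (f : I → Carrier) (i : I) → f i ≤ ⨆ f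
    ⨆-least : ∀ {I : Set ι} (f : I → Carrier) (x : Carrier) → (∀ i → f i ≤ x) → ⨆ f ≤ x
    _⊔K_     : Carrier → Carrier → Carrier
    ⊔-upperˡ : ∀ x y → x ≤ x ⊔K y
    ⊔-upperʳ : ∀ x y → y ≤ x ⊔K y
    ⊔-least  : ∀ x y z → x ≤ z → y ≤ z → x ⊔K y ≤ z
    _⊙_ : Carrier → Carrier → Carrier
    e   : Carrier
    ⊙-cong  : ∀ {x x' y y'} → x ≈ x' → y ≈ y' → x ⊙ y ≈ x' ⊙ y'
    ⊙-assoc : ∀ x y z → (x ⊙ y) ⊙ z ≈ x ⊙ (y ⊙ z)
    ⊙-identityˡ : ∀ x → e ⊙ x ≈ x
    ⊙-identityʳ : ∀ x → x ⊙ e ≈ x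
    ⊙-distribˡ-⨆ : ∀ {I : Set ι} (x : Carrier) (f : I → Carrier) → x ⊙ ⨆ f ≈ ⨆ (λ i → x ⊙ f i)
    ⊙-distribʳ-⨆ : ∀ {I : Set ι} (x : Carrier) (f : I → Carrier) → ⨆ f ⊙ x ≈ ⨆ (λ i → f i ⊙ x)
    _*  : Carrier → Carrier
    *-cong : ∀ {x y} → x ≈ y → x * ≈ y *
    *-involutive : ∀ x → (x *) * ≈ x
    *-antihom : ∀ x y → (x ⊙ y) * ≈ (y *) ⊙ (x *)
    *-⨆ : ∀ {I : Set ι} (f : I → Carrier) → (⨆ f) * ≈ ⨆ (λ i → f i *)
    ∼_ : Carrier → Carrier
    ∼-cong : ∀ {x y} → x ≈ y → ∼ x ≈ ∼ y
    ∼-⊙  : ∀ x y → ∼ (x ⊙ ∼ ∼ y) ≈ ∼ (x ⊙ y)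
    ∼-⨆  : ∀ {I : Set ι} (f : I → Carrier) → ∼ ⨆ (λ i → ∼ ∼ f i) ≈ ∼ ⨆ f
    ∼-*  : ∀ x → (∼ x) * ≈ ∼ x
    ∼-ax4 : ∀ x y → ∼ ∼ (∼ ∼ x ⊙ y) ≈ ∼ (∼ x ⊔K ∼ (∼ x ⊔K y))

  sig : Sig c ℓ
  sig = record { Carrier = Carrier ; _≈_ = _≈_ ; e = e ; _⊙_ = _⊙_ ; _* = _* ; ∼_ = ∼_ }

  Test : Set (c ⊔ ℓ)
  Test = Σ Carrier (IsTest sig)

  -- ⋁ W = ∼∼ ⨆ W ; k ⪯ l iff ⋁{k,l} = l ; w^⊥ = ∼ w
  _⪯_ : Rel Test ℓ
  (k , _) ⪯ (l , _) = ∼ ∼ (k ⊔K l) ≈ l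

  _≈ₜ_ : Rel Test ℓ
  (k , _) ≈ₜ (l , _) = k ≈ l

  _⊥ₜ : Test → Test
  (w , _) ⊥ₜ = ∼ w , w , isEquivalence-refl
    where
      isEquivalence-refl : ∼ w ≈ ∼ w
      isEquivalence-refl = IsEquivalence.refl (IsPartialOrder.isEquivalence isPartialOrder)

  _•_ : Carrier → Test → Carrier
  k • (v , _) = ∼ ∼ (k ⊙ v)

  _≡ₖ_ : Rel Carrier (c ⊔ ℓ)
  k ≡ₖ l = ∀ (w : Test) → k • w ≈ l • w

  testElem : Test → 𝒯Elem sig
  testElem (w , k , w≈∼k) =
    w , 𝒯-resp (IsEquivalence.sym (IsPartialOrder.isEquivalence isPartialOrder) w≈∼k) (𝒯-test k)

IsSemiFoulis : ∀ {c ℓ ι} → IDA c ℓ ι → Set (lsuc ι ⊔ c ⊔ ℓ)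
IsSemiFoulis {ι = ι} K = IsCompleteOML ι Test _≈ₜ_ _⪯_ _⊥ₜ
  where open IDA K

testOML : ∀ {c ℓ ι} (K : IDA c ℓ ι) → IsSemiFoulis K → CompleteOML (c ⊔ ℓ) ℓ ℓ ι
testOML K SF = record
  { Carrier = IDA.Test K ; _≈_ = IDA._≈ₜ_ K ; _≤_ = IDA._⪯_ K ; _ᶜ = IDA._⊥ₜ K
  ; isCompleteOML = SF }

record IDAMorphism {c₁ ℓ₁ c₂ ℓ₂ ι} (K₁ : IDA c₁ ℓ₁ ι) (K₂ : IDA c₂ ℓ₂ ι)
       : Set (lsuc ι ⊔ c₁ ⊔ ℓ₁ ⊔ c₂ ⊔ ℓ₂) where
  private
    module A = IDA K₁
    module B = IDA K₂
  field
    map   : A.Carrier → B.Carrier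
    cong  : ∀ {x y} → x A.≈ y → map x B.≈ map y
    map-⨆ : ∀ {I : Set ι} (f : I → A.Carrier) → map (A.⨆ f) B.≈ B.⨆ (λ i → map (f i))
    map-⊙ : ∀ x y → map (x A.⊙ y) B.≈ map x B.⊙ map y
    map-e : map A.e B.≈ B.e
    map-* : ∀ x → map (x A.*) B.≈ (map x) B.*
    map-∼ : ∀ x → map (A.∼ x) B.≈ B.∼ (map x)

module LinOf {c ℓ₁ ℓ₂ ι} (M : CompleteOML c ℓ₁ ℓ₂ ι) where
  open CompleteOML M
  private
    module PO = IsPartialOrder isPartialOrder
    module Eq = IsEquivalence PO.isEquivalence

  π : Carrier → Carrier → Carrier
  π m x = m ∧ ((m ᶜ) ∨ x)

  record LinMap : Set (c ⊔ ℓ₂) where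
    field
      fun adj : Carrier → Carrier
      adjoint : ∀ x y → (fun x ≤ (y ᶜ)) ⇔ (x ≤ (adj y ᶜ))
  open LinMap public

  _≈L_ : Rel LinMap (c ⊔ ℓ₁)
  f ≈L g = ∀ x → fun f x ≈ fun g x

  private
    ᶜᶜ-≥ : ∀ x → x ≤ ((x ᶜ) ᶜ)
    ᶜᶜ-≥ x = PO.reflexive (Eq.sym (ᶜ-involutive x))

    ᶜᶜ-≤ : ∀ x → ((x ᶜ) ᶜ) ≤ x
    ᶜᶜ-≤ x = PO.reflexive (ᶜ-involutive x)

    swap : ∀ {x y} → x ≤ (y ᶜ) → y ≤ (x ᶜ)
    swap {x} {y} p = PO.trans (ᶜᶜ-≥ y) (ᶜ-antitone p)

    ∨-monoʳ : ∀ a {x y} → x ≤ y → (a ∨ x) ≤ (a ∨ y)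
    ∨-monoʳ a {x} {y} p =
      ∨-least a x (a ∨ y) (∨-upperˡ a y) (PO.trans p (∨-upperʳ a y))

    ∧-monoˡ : ∀ {x y} b → x ≤ y → (x ∧ b) ≤ (y ∧ b)
    ∧-monoˡ {x} {y} b p =
      ∧-greatest y b (x ∧ b) (PO.trans (∧-lowerˡ x b) p) (∧-lowerʳ x b)

    stepA : ∀ m x → x ≤ ((m ᶜ) ∨ π m x)
    stepA m x =
      PO.trans (∨-upperʳ (m ᶜ) x)
        (PO.trans (PO.reflexive (orthomodular (∨-upperˡ (m ᶜ) x)))
          (∨-monoʳ (m ᶜ) (∧-monoˡ ((m ᶜ) ∨ x) (ᶜᶜ-≤ m))))

    stepC : ∀ m y → ((m ᶜ) ∨ (m ∧ (y ᶜ))) ≤ (π m y ᶜ)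
    stepC m y =
      ∨-least (m ᶜ) (m ∧ (y ᶜ)) (π m y ᶜ)
        (ᶜ-antitone (∧-lowerˡ m ((m ᶜ) ∨ y)))
        (swap (PO.trans (∧-lowerʳ m ((m ᶜ) ∨ y))
          (∨-least (m ᶜ) y ((m ∧ (y ᶜ)) ᶜ)
            (ᶜ-antitone (∧-lowerˡ m (y ᶜ)))
            (PO.trans (ᶜᶜ-≥ y) (ᶜ-antitone (∧-lowerʳ m (y ᶜ)))))))

    π-adj→ : ∀ m x y → π m x ≤ (y ᶜ) → x ≤ (π m y ᶜ)
    π-adj→ m x y p =
      PO.trans (stepA m x)
        (PO.trans (∨-monoʳ (m ᶜ) (∧-greatest m (y ᶜ) (π m x) (∧-lowerˡ m ((m ᶜ) ∨ x)) p))
          (stepC m y))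

    π-adj← : ∀ m x y → x ≤ (π m y ᶜ) → π m x ≤ (y ᶜ)
    π-adj← m x y p = swap (π-adj→ m y x (swap p))

  idL : LinMap
  idL = record { fun = λ x → x ; adj = λ x → x ; adjoint = λ x y → mk⇔ (λ p → p) (λ p → p) }

  _∘L_ : LinMap → LinMap → LinMap
  f ∘L g = record
    { fun = λ x → fun f (fun g x)
    ; adj = λ y → adj g (adj f y)
    ; adjoint = λ x y → mk⇔
        (λ p → Equivalence.to (adjoint g x (adj f y)) (Equivalence.to (adjoint f (fun g x) y) p))
        (λ p → Equivalence.from (adjoint f (fun g x) y) (Equivalence.from (adjoint g x (adj f y)) p)) }

  _*L : LinMap → LinMap
  f *L = record
    { fun = adj f
    ; adj = fun f
    ; adjoint = λ x y → mk⇔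
        (λ p → swap (Equivalence.from (adjoint f y x) (swap p)))
        (λ p → swap (Equivalence.to (adjoint f y x) (swap p))) }

  πL : Carrier → LinMap
  πL m = record { fun = π m ; adj = π m
                ; adjoint = λ x y → mk⇔ (π-adj→ m x y) (π-adj← m x y) }

  ∼L : LinMap → LinMap
  ∼L f = πL (fun f 𝟙 ᶜ)

  LinSig : Sig (c ⊔ ℓ₂) (c ⊔ ℓ₁)
  LinSig = record { Carrier = LinMap ; _≈_ = _≈L_ ; e = idL ; _⊙_ = _∘L_ ; _* = _*L ; ∼_ = ∼L }

module PowOf {c ℓ₁ ℓ₂} (M : CompleteOML c ℓ₁ ℓ₂ (c ⊔ ℓ₁ ⊔ ℓ₂)) where
  open CompleteOML M
  open LinOf M

  L : Set (c ⊔ ℓ₁ ⊔ ℓ₂)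
  L = 𝒯Elem LinSig

  Subset : Set (lsuc (c ⊔ ℓ₁ ⊔ ℓ₂))
  Subset = L → Set (c ⊔ ℓ₁ ⊔ ℓ₂)

  _≐_ : Rel Subset (c ⊔ ℓ₁ ⊔ ℓ₂)
  A ≐ B = ∀ a → A a ⇔ B a

  eP : Subset
  eP g = Lift (c ⊔ ℓ₁ ⊔ ℓ₂) (proj₁ g ≈L idL)

  _⊙P_ : Subset → Subset → Subset
  (A ⊙P B) g = Σ L λ a → Σ L λ b → A a × B b × (proj₁ g ≈L (proj₁ a ∘L proj₁ b))

  _*P : Subset → Subset
  (A *P) g = Σ L λ a → A a × (proj₁ g ≈L (proj₁ a *L))

  ∼P : Subset → Subset
  ∼P A g = Lift (c ⊔ ℓ₁ ⊔ ℓ₂) (proj₁ g ≈L πL ((⋁ {I = Σ L A} (λ p → fun (proj₁ (proj₁ p)) 𝟙)) ᶜ))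

  PSig : Sig (lsuc (c ⊔ ℓ₁ ⊔ ℓ₂)) (c ⊔ ℓ₁ ⊔ ℓ₂)
  PSig = record { Carrier = Subset ; _≈_ = _≐_ ; e = eP ; _⊙_ = _⊙P_ ; _* = _*P ; ∼_ = ∼P }

  ｛_｝ : LinMap → Subset
  ｛ f ｝ g = Lift (c ⊔ ℓ₁ ⊔ ℓ₂) (proj₁ g ≈L f)

Part1 : ∀ {c ℓ ι} → IDA c ℓ ι → Set (c ⊔ ℓ)
Part1 K =
  (∀ w → IsTest sig w → 𝒯 sig w) ×
  𝒯 sig e ×
  (∀ x y → 𝒯 sig x → 𝒯 sig y → 𝒯 sig (x ⊙ y)) ×
  (∀ x → 𝒯 sig x → 𝒯 sig (x *))
  where open IDA K

Separated : ∀ {c ℓ ι} → IDA c ℓ ι → Set (c ⊔ ℓ)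
Separated K = ∀ s t → 𝒯 sig s → 𝒯 sig t → (s ≈ t) ⇔ (s ≡ₖ t)
  where open IDA K

record Part2 {c ℓ ι} (K : IDA c ℓ ι) (SF : IsSemiFoulis K) : Set (lsuc ι ⊔ c ⊔ ℓ) where
  open IDA K
  private
    𝕄 = testOML K SF
    module 𝕄 = CompleteOML 𝕄
  open LinOf 𝕄
  field
    ν     : 𝒯Elem sig → 𝒯Elem LinSig
    ν-def : ∀ (s : 𝒯Elem sig) (w : Test) → proj₁ (fun (proj₁ (ν s)) w) ≈ (proj₁ s • w)
    ν-iso : IsInvMonoidIso sig LinSig ν
    ν-test-into : ∀ (w : Test) → Σ Test λ u → proj₁ (ν (testElem w)) ≈L πL u
    ν-test-onto : ∀ (u : Test) → Σ Test λ w → proj₁ (ν (testElem w)) ≈L πL u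
    ν-test-mono : ∀ (w w' : Test) → w ⪯ w' →
                  proj₁ (ν (testElem w)) ≈L (proj₁ (ν (testElem w')) ∘L proj₁ (ν (testElem w)))

record Part3 {c ℓ₁ ℓ₂} (M : CompleteOML c ℓ₁ ℓ₂ (c ⊔ ℓ₁ ⊔ ℓ₂)) : Set (lsuc (c ⊔ ℓ₁ ⊔ ℓ₂)) where
  open LinOf M
  open PowOf M
  field
    μ     : 𝒯Elem LinSig → 𝒯Elem PSig
    μ-def : ∀ (f : 𝒯Elem LinSig) → proj₁ (μ f) ≐ ｛ proj₁ f ｝
    μ-iso : IsInvMonoidIso LinSig PSig μ

Part4 : ∀ {c₁ ℓ₁ c₂ ℓ₂ ι} {K₁ : IDA c₁ ℓ₁ ι} {K₂ : IDA c₂ ℓ₂ ι} →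
        IDAMorphism K₁ K₂ → Set (c₁ ⊔ ℓ₁ ⊔ c₂ ⊔ ℓ₂)
Part4 {K₁ = K₁} {K₂ = K₂} f =
  Σ (∀ x → 𝒯 (IDA.sig K₁) x → 𝒯 (IDA.sig K₂) (IDAMorphism.map f x)) λ h →
    IsInvMonoidHom (IDA.sig K₁) (IDA.sig K₂) (λ a → IDAMorphism.map f (proj₁ a) , h (proj₁ a) (proj₂ a))

module Submission where

-- For (2), the join of two tests in the orthomodular lattice K̃ is ∼∼(a ⊔ b),
-- so the fourth axiom for ∼ says w • x = w ∧ (w^⊥ ∨ x) = π_w(x): tests act on
-- tests by Sasaki projections. By induction over 𝒯(K), every s ∈ 𝒯(K) then acts
-- by a map in 𝒯(Lin(K̃)) whose adjoint is the action of s*. This map is ν(s); it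
-- is unique, hence ν is a homomorphism, injective by the separation hypothesis,
-- and onto because its image contains the generating projections. For (3),
-- f ↦ {f} preserves e, ⊙, * and tests (∼P {π_m} = {π_{m^⊥}}), is clearly
-- injective, and is onto for the same reason.

open import Defs
open import Level using (Level; _⊔_; Lift; lift; lower)
open import Data.Bool using (Bool; true; false; if_then_else_)
open import Data.Product using (_×_; Σ; _,_; proj₁; proj₂)
open import Function.Bundles using (mk⇔; Equivalence)
open import Function.Properties.Equivalence using (⇔-isEquivalence)
open import Relation.Binary.Bundles using (Poset)
open import Relation.Binary.Lattice.Bundles using (JoinSemilattice; MeetSemilattice)
open import Relation.Binary.Structures using (IsPartialOrder; IsEquivalence)
import Relation.Binary.Lattice.Properties.JoinSemilattice as JoinSemilatticeProperties
import Relation.Binary.Lattice.Properties.MeetSemilattice as MeetSemilatticeProperties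
import Relation.Binary.Reasoning.PartialOrder as PosetReasoning

record IsCongruent {c ℓ} (S : Sig c ℓ) : Set (c ⊔ ℓ) where
  open Sig S
  field
    isEquivalence : IsEquivalence _≈_
    ⊙-cong : ∀ {x x' y y'} → x ≈ x' → y ≈ y' → x ⊙ y ≈ x' ⊙ y'
    *-cong : ∀ {x y} → x ≈ y → (x *) ≈ (y *)
  open IsEquivalence isEquivalence public

module _ {c₁ ℓ₁ c₂ ℓ₂} {S₁ : Sig c₁ ℓ₁} {S₂ : Sig c₂ ℓ₂} (C₂ : IsCongruent S₂) where
  private
    module A = Sig S₁
    module B = Sig S₂
    module C₂ = IsCongruent C₂

  hitsTests⇒surjective : ∀ {φ} → IsInvMonoidHom S₁ S₂ φ →
    (∀ k → Σ (𝒯Elem S₁) λ a → proj₁ (φ a) B.≈ B.∼ k) →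
    ∀ (b : 𝒯Elem S₂) → Σ (𝒯Elem S₁) λ a → proj₁ (φ a) B.≈ proj₁ b
  hitsTests⇒surjective {φ} hom hits (_ , b∈𝒯) = preimage b∈𝒯
    where
      open IsInvMonoidHom hom
      preimage : ∀ {y} → 𝒯 S₂ y → Σ (𝒯Elem S₁) λ a → proj₁ (φ a) B.≈ y
      preimage (𝒯-test k) = hits k
      preimage 𝒯-e = (A.e , 𝒯-e) , φ-e 𝒯-e
      preimage (𝒯-⊙ p q) with preimage p | preimage q
      ... | a , φa≈x | b , φb≈y =
        (proj₁ a A.⊙ proj₁ b , 𝒯-⊙ (proj₂ a) (proj₂ b)) ,
        C₂.trans (φ-⊙ a b _) (C₂.⊙-cong φa≈x φb≈y)
      preimage (𝒯-* p) with preimage p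
      ... | a , φa≈x = (proj₁ a A.* , 𝒯-* (proj₂ a)) , C₂.trans (φ-* a _) (C₂.*-cong φa≈x)
      preimage (𝒯-resp x≈y p) with preimage p
      ... | a , φa≈x = a , C₂.trans φa≈x x≈y

  -- ⊙ and * need only be preserved on 𝒯: for f ↦ {f}, the subsets in 𝒫(L) only see elements of L = 𝒯.
  module Restriction
    (f : A.Carrier → B.Carrier)
    (f-cong : ∀ {x y} → x A.≈ y → f x B.≈ f y)
    (f-test : ∀ k → 𝒯 S₂ (f (A.∼ k)))
    (f-e : f A.e B.≈ B.e)
    (f-⊙ : ∀ {x y} → 𝒯 S₁ x → 𝒯 S₁ y → f (x A.⊙ y) B.≈ f x B.⊙ f y)
    (f-* : ∀ {x} → 𝒯 S₁ x → f (x A.*) B.≈ (f x B.*))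
    where

    f-𝒯 : ∀ x → 𝒯 S₁ x → 𝒯 S₂ (f x)
    f-𝒯 _ (𝒯-test k) = f-test k
    f-𝒯 _ 𝒯-e = 𝒯-resp (C₂.sym f-e) 𝒯-e
    f-𝒯 _ (𝒯-⊙ p q) = 𝒯-resp (C₂.sym (f-⊙ p q)) (𝒯-⊙ (f-𝒯 _ p) (f-𝒯 _ q))
    f-𝒯 _ (𝒯-* p) = 𝒯-resp (C₂.sym (f-* p)) (𝒯-* (f-𝒯 _ p))
    f-𝒯 _ (𝒯-resp x≈y p) = 𝒯-resp (f-cong x≈y) (f-𝒯 _ p)

    restrict : 𝒯Elem S₁ → 𝒯Elem S₂
    restrict (x , x∈𝒯) = f x , f-𝒯 x x∈𝒯

    restrict-isHom : IsInvMonoidHom S₁ S₂ restrict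
    restrict-isHom = record
      { φ-cong = λ _ _ → f-cong
      ; φ-e = λ _ → f-e
      ; φ-⊙ = λ a b _ → f-⊙ (proj₂ a) (proj₂ b)
      ; φ-* = λ a _ → f-* (proj₂ a) }

module OMLProperties {c ℓ₁ ℓ₂ ι} (M : CompleteOML c ℓ₁ ℓ₂ ι) where
  open CompleteOML M
  open LinOf M

  poset : Poset c ℓ₁ ℓ₂
  poset = record { isPartialOrder = isPartialOrder }

  open Poset poset public using (refl; trans; antisym; reflexive; ≤-respˡ-≈; ≤-respʳ-≈; module Eq)
  open PosetReasoning poset

  joinSemilattice : JoinSemilattice c ℓ₁ ℓ₂
  joinSemilattice = record
    { _∨_ = _∨_
    ; isJoinSemilattice = record
      { isPartialOrder = isPartialOrder
      ; supremum = λ x y → ∨-upperˡ x y , ∨-upperʳ x y , ∨-least x y } }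

  meetSemilattice : MeetSemilattice c ℓ₁ ℓ₂
  meetSemilattice = record
    { _∧_ = _∧_
    ; isMeetSemilattice = record
      { isPartialOrder = isPartialOrder
      ; infimum = λ x y → ∧-lowerˡ x y , ∧-lowerʳ x y , λ z → ∧-greatest x y z } }

  open JoinSemilatticeProperties joinSemilattice public using (∨-cong)
  open JoinSemilatticeProperties (MeetSemilatticeProperties.dualJoinSemilattice meetSemilattice)
    public using () renaming (∨-cong to ∧-cong)

  ᶜ-cong : ∀ {x y} → x ≈ y → (x ᶜ) ≈ (y ᶜ)
  ᶜ-cong x≈y = antisym (ᶜ-antitone (reflexive (Eq.sym x≈y))) (ᶜ-antitone (reflexive x≈y))

  ᶜ-swap : ∀ {x y} → x ≤ (y ᶜ) → y ≤ (x ᶜ)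
  ᶜ-swap {x} {y} x≤yᶜ = begin
    y           ≈⟨ ᶜ-involutive y ⟨
    ((y ᶜ) ᶜ)   ≤⟨ ᶜ-antitone x≤yᶜ ⟩
    (x ᶜ)       ∎

  ᶜ-∨ : ∀ x y → ((x ∨ y) ᶜ) ≈ ((x ᶜ) ∧ (y ᶜ))
  ᶜ-∨ x y = antisym
    (∧-greatest (x ᶜ) (y ᶜ) _ (ᶜ-antitone (∨-upperˡ x y)) (ᶜ-antitone (∨-upperʳ x y)))
    (ᶜ-swap (∨-least x y _ (ᶜ-swap (∧-lowerˡ (x ᶜ) (y ᶜ))) (ᶜ-swap (∧-lowerʳ (x ᶜ) (y ᶜ)))))

  ᶜ-∧ : ∀ x y → ((x ∧ y) ᶜ) ≈ ((x ᶜ) ∨ (y ᶜ))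
  ᶜ-∧ x y = begin-equality
    ((x ∧ y) ᶜ)                       ≈⟨ ᶜ-cong (∧-cong (ᶜ-involutive x) (ᶜ-involutive y)) ⟨
    ((((x ᶜ) ᶜ) ∧ ((y ᶜ) ᶜ)) ᶜ)       ≈⟨ ᶜ-cong (ᶜ-∨ (x ᶜ) (y ᶜ)) ⟨
    ((((x ᶜ) ∨ (y ᶜ)) ᶜ) ᶜ)           ≈⟨ ᶜ-involutive _ ⟩
    ((x ᶜ) ∨ (y ᶜ))                   ∎

  ∧≈ᶜ∨ᶜ : ∀ x y → (x ∧ y) ≈ (((x ᶜ) ∨ (y ᶜ)) ᶜ)
  ∧≈ᶜ∨ᶜ x y = begin-equality
    (x ∧ y)                   ≈⟨ ᶜ-involutive _ ⟨
    (((x ∧ y) ᶜ) ᶜ)           ≈⟨ ᶜ-cong (ᶜ-∧ x y) ⟩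
    (((x ᶜ) ∨ (y ᶜ)) ᶜ)       ∎

  π-cong : ∀ {m m' x x'} → m ≈ m' → x ≈ x' → π m x ≈ π m' x'
  π-cong m≈m' x≈x' = ∧-cong m≈m' (∨-cong (ᶜ-cong m≈m') x≈x')

  π-𝟙 : ∀ m → π m 𝟙 ≈ m
  π-𝟙 m = antisym (∧-lowerˡ m _) (∧-greatest m _ m refl (trans (𝟙-greatest m) (∨-upperʳ (m ᶜ) 𝟙)))

  -- The dual form of the orthomodular law.
  π-fixes-below : ∀ {m z} → z ≤ m → π m z ≈ z
  π-fixes-below {m} {z} z≤m = Eq.sym (begin-equality
    z                                          ≈⟨ ᶜ-involutive z ⟨
    ((z ᶜ) ᶜ)                                  ≈⟨ ᶜ-cong (orthomodular (ᶜ-antitone z≤m)) ⟩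
    (((m ᶜ) ∨ (((m ᶜ) ᶜ) ∧ (z ᶜ))) ᶜ)          ≈⟨ ᶜ-∨ (m ᶜ) _ ⟩
    (((m ᶜ) ᶜ) ∧ ((((m ᶜ) ᶜ) ∧ (z ᶜ)) ᶜ))      ≈⟨ ∧-cong Eq.refl (ᶜ-∧ _ (z ᶜ)) ⟩
    (((m ᶜ) ᶜ) ∧ ((((m ᶜ) ᶜ) ᶜ) ∨ ((z ᶜ) ᶜ)))  ≈⟨ π-cong (ᶜ-involutive m) (ᶜ-involutive z) ⟩
    π m z                                      ∎)

  πL-absorbs-below : ∀ {m n} → m ≤ n → (πL n ∘L πL m) ≈L πL m
  πL-absorbs-below {m} {n} m≤n x = π-fixes-below (trans (∧-lowerˡ m _) m≤n)

  πL-cong : ∀ {m m'} → m ≈ m' → πL m ≈L πL m'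
  πL-cong m≈m' x = π-cong m≈m' Eq.refl

  πL∈𝒯 : ∀ m → 𝒯 LinSig (πL m)
  πL∈𝒯 m = 𝒯-resp (πL-cong (Eq.trans (ᶜ-cong (π-𝟙 (m ᶜ))) (ᶜ-involutive m))) (𝒯-test (πL (m ᶜ)))

  fun-mono : ∀ (f : LinMap) {x y} → x ≤ y → fun f x ≤ fun f y
  fun-mono f {x} {y} x≤y = ≤-respʳ-≈ (ᶜ-involutive (fun f y))
    (Equivalence.from (adjoint f x (fun f y ᶜ))
      (trans x≤y (Equivalence.to (adjoint f y (fun f y ᶜ)) (reflexive (Eq.sym (ᶜ-involutive _))))))

  fun-cong : ∀ (f : LinMap) {x y} → x ≈ y → fun f x ≈ fun f y
  fun-cong f x≈y = antisym (fun-mono f (reflexive x≈y)) (fun-mono f (reflexive (Eq.sym x≈y)))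

  *L-mono : ∀ {f g : LinMap} → (∀ x → fun f x ≤ fun g x) → ∀ y → adj f y ≤ adj g y
  *L-mono {f} {g} f≤g y = ≤-respʳ-≈ (ᶜ-involutive _) (≤-respˡ-≈ (ᶜ-involutive _) (ᶜ-antitone
    (Equivalence.to (adjoint f x y)
      (trans (f≤g x) (Equivalence.from (adjoint g x y) refl)))))
    where
      x : Carrier
      x = adj g y ᶜ

  *L-cong : ∀ {f g} → f ≈L g → (f *L) ≈L (g *L)
  *L-cong {f} {g} f≈g y = antisym
    (*L-mono {f} {g} (λ x → reflexive (f≈g x)) y)
    (*L-mono {g} {f} (λ x → reflexive (Eq.sym (f≈g x))) y)

  ∘L-cong : ∀ {f f' g g'} → f ≈L f' → g ≈L g' → (f ∘L g) ≈L (f' ∘L g')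
  ∘L-cong {f} {f'} {g} {g'} f≈f' g≈g' x = Eq.trans (fun-cong f (g≈g' x)) (f≈f' (fun g' x))

  linCongruence : IsCongruent LinSig
  linCongruence = record
    { isEquivalence = record
      { refl = λ _ → Eq.refl
      ; sym = λ f≈g x → Eq.sym (f≈g x)
      ; trans = λ f≈g g≈h x → Eq.trans (f≈g x) (g≈h x) }
    ; ⊙-cong = λ {f} {f'} {g} {g'} → ∘L-cong {f} {f'} {g} {g'}
    ; *-cong = λ {f} {g} → *L-cong {f} {g} }

idaCongruence : ∀ {c ℓ ι} (K : IDA c ℓ ι) → IsCongruent (IDA.sig K)
idaCongruence K = record
  { isEquivalence = IsPartialOrder.isEquivalence isPartialOrder ; ⊙-cong = ⊙-cong ; *-cong = *-cong }
  where open IDA K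

𝒯-isInvolutiveSubmonoid : ∀ {c ℓ ι} (K : IDA c ℓ ι) → Part1 K
𝒯-isInvolutiveSubmonoid K = (λ w w∈K̃ → proj₂ (IDA.testElem K (w , w∈K̃))) , 𝒯-e , (λ _ _ → 𝒯-⊙) , (λ _ → 𝒯-*)

𝒯-restrictsMorphism : ∀ {c₁ ℓ₁ c₂ ℓ₂ ι} {K₁ : IDA c₁ ℓ₁ ι} {K₂ : IDA c₂ ℓ₂ ι}
  (f : IDAMorphism K₁ K₂) → Part4 f
𝒯-restrictsMorphism {K₂ = K₂} f = f-𝒯 , restrict-isHom
  where
    open IDAMorphism f
    open Restriction (idaCongruence K₂) map cong
      (λ k → 𝒯-resp (IsCongruent.sym (idaCongruence K₂) (map-∼ k)) (𝒯-test (map k))) map-e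
      (λ {x} {y} _ _ → map-⊙ x y) (λ {x} _ → map-* x)

module SingletonEmbedding {c ℓ₁ ℓ₂} (M : CompleteOML c ℓ₁ ℓ₂ (c ⊔ ℓ₁ ⊔ ℓ₂)) where
  open CompleteOML M
  open LinOf M
  open PowOf M
  open OMLProperties M
  private
    module ⇔ {ℓ} = IsEquivalence (⇔-isEquivalence {ℓ})

  powCongruence : IsCongruent PSig
  powCongruence = record
    { isEquivalence = record
      { refl = λ _ → ⇔.refl
      ; sym = λ A≐B a → ⇔.sym (A≐B a)
      ; trans = λ A≐B B≐C a → ⇔.trans (A≐B a) (B≐C a) }
    ; ⊙-cong = λ A≐A' B≐B' _ → mk⇔
        (λ { (a , b , a∈A , b∈B , g≈ab) → a , b , Equivalence.to (A≐A' a) a∈A , Equivalence.to (B≐B' b) b∈B , g≈ab })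
        (λ { (a , b , a∈A , b∈B , g≈ab) → a , b , Equivalence.from (A≐A' a) a∈A , Equivalence.from (B≐B' b) b∈B , g≈ab })
    ; *-cong = λ A≐A' _ → mk⇔
        (λ { (a , a∈A , g≈a* ) → a , Equivalence.to (A≐A' a) a∈A , g≈a* })
        (λ { (a , a∈A , g≈a* ) → a , Equivalence.from (A≐A' a) a∈A , g≈a* }) }

  ｛｝-cong : ∀ {f g} → f ≈L g → ｛ f ｝ ≐ ｛ g ｝
  ｛｝-cong {f} {g} f≈g _ = mk⇔
    (λ h≈f → lift (λ x → Eq.trans (lower h≈f x) (f≈g x)))
    (λ h≈g → lift (λ x → Eq.trans (lower h≈g x) (Eq.sym (f≈g x))))

  ｛｝-∘ : ∀ (f g : L) → ｛ proj₁ f ∘L proj₁ g ｝ ≐ (｛ proj₁ f ｝ ⊙P ｛ proj₁ g ｝)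
  ｛｝-∘ f g _ = mk⇔
    (λ h≈fg → f , g , lift (λ _ → Eq.refl) , lift (λ _ → Eq.refl) , lower h≈fg)
    (λ { (a , b , a≈f , b≈g , h≈ab) →
           lift (λ x → Eq.trans (h≈ab x) (∘L-cong {proj₁ a} {proj₁ f} {proj₁ b} {proj₁ g} (lower a≈f) (lower b≈g) x)) })

  ｛｝-* : ∀ (f : L) → ｛ proj₁ f *L ｝ ≐ (｛ proj₁ f ｝ *P)
  ｛｝-* f _ = mk⇔
    (λ h≈f* → f , lift (λ _ → Eq.refl) , lower h≈f*)
    (λ { (a , a≈f , h≈a*) → lift (λ x → Eq.trans (h≈a* x) (*L-cong {proj₁ a} {proj₁ f} (lower a≈f) x)) })

  ⋁-at-𝟙 : Subset → Carrier
  ⋁-at-𝟙 A = ⋁ {I = Σ L A} (λ a → fun (proj₁ (proj₁ a)) 𝟙)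

  ⋁-｛πL｝ : ∀ m → ⋁-at-𝟙 ｛ πL m ｝ ≈ m
  ⋁-｛πL｝ m = antisym
    (⋁-least _ m (λ a → reflexive (Eq.trans (lower (proj₂ a) 𝟙) (π-𝟙 m))))
    (≤-respˡ-≈ (π-𝟙 m) (⋁-upper (λ a → fun (proj₁ (proj₁ a)) 𝟙) ((πL m , πL∈𝒯 m) , lift (λ _ → Eq.refl))))

  -- ∼L f = π_{f(𝟙)^⊥}, while ∼P {π_{f(𝟙)}} = {π_{f(𝟙)^⊥}} because π_m(𝟙) = m.
  ｛∼L｝∈𝒯 : ∀ f → 𝒯 PSig ｛ ∼L f ｝
  ｛∼L｝∈𝒯 f = 𝒯-resp (｛｝-cong {πL (⋁-at-𝟙 ｛ πL (fun f 𝟙) ｝ ᶜ)} {∼L f} (πL-cong (ᶜ-cong (⋁-｛πL｝ (fun f 𝟙)))))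
    (𝒯-test ｛ πL (fun f 𝟙) ｝)

  open Restriction powCongruence ｛_｝ (λ {f} {g} → ｛｝-cong {f} {g}) ｛∼L｝∈𝒯 (λ _ → ⇔.refl)
    (λ f∈𝒯 g∈𝒯 → ｛｝-∘ (_ , f∈𝒯) (_ , g∈𝒯)) (λ f∈𝒯 → ｛｝-* (_ , f∈𝒯))

  singletonEmbedding : Part3 M
  singletonEmbedding = record
    { μ = restrict
    ; μ-def = λ _ _ → ⇔.refl
    ; μ-iso = record
      { isHom = restrict-isHom
      ; injective = λ f g ｛f｝≐｛g｝ → lower (Equivalence.to (｛f｝≐｛g｝ f) (lift (λ _ → Eq.refl)))
      ; surjective = hitsTests⇒surjective powCongruence restrict-isHom
          -- ∼P A is by definition the singleton of a Sasaki projection.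
          (λ A → (_ , πL∈𝒯 _) , λ _ → ⇔.refl) } }

module IDAProperties {c ℓ ι} (K : IDA c ℓ ι) where
  open IDA K

  poset : Poset c ℓ ℓ
  poset = record { isPartialOrder = isPartialOrder }

  open Poset poset public using (module Eq)
  open Poset poset using (antisym)
  open PosetReasoning poset

  joinSemilattice : JoinSemilattice c ℓ ℓ
  joinSemilattice = record
    { _∨_ = _⊔K_
    ; isJoinSemilattice = record
      { isPartialOrder = isPartialOrder
      ; supremum = λ x y → ⊔-upperˡ x y , ⊔-upperʳ x y , ⊔-least x y } }

  open JoinSemilatticeProperties joinSemilattice public
    using () renaming (∨-cong to ⊔-cong; ∨-assoc to ⊔-assoc; ∨-idempotent to ⊔-idem; x≤y⇒x∨y≈y to x≤y⇒x⊔y≈y)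

  ⨆-pair : (f : Lift ι Bool → Carrier) → ⨆ f ≈ f (lift true) ⊔K f (lift false)
  ⨆-pair f = antisym
    (⨆-least f _ λ { (lift true) → ⊔-upperˡ _ _ ; (lift false) → ⊔-upperʳ _ _ })
    (⊔-least _ _ _ (⨆-upper f (lift true)) (⨆-upper f (lift false)))

  ∼-⊔-∼∼ : ∀ p q → ∼ (∼ ∼ p ⊔K ∼ ∼ q) ≈ ∼ (p ⊔K q)
  ∼-⊔-∼∼ p q = begin-equality
    ∼ (∼ ∼ p ⊔K ∼ ∼ q)             ≈⟨ ∼-cong (⨆-pair (λ i → ∼ ∼ pair i)) ⟨
    ∼ ⨆ (λ i → ∼ ∼ pair i)         ≈⟨ ∼-⨆ pair ⟩
    ∼ ⨆ pair                       ≈⟨ ∼-cong (⨆-pair pair) ⟩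
    ∼ (p ⊔K q)                     ∎
    where
      pair : Lift ι Bool → Carrier
      pair i = if lower i then p else q

  ∼∼∼ : ∀ x → ∼ ∼ ∼ x ≈ ∼ x
  ∼∼∼ x = begin-equality
    ∼ ∼ ∼ x                 ≈⟨ ∼-cong (⊔-idem (∼ ∼ x)) ⟨
    ∼ (∼ ∼ x ⊔K ∼ ∼ x)      ≈⟨ ∼-⊔-∼∼ x x ⟩
    ∼ (x ⊔K x)              ≈⟨ ∼-cong (⊔-idem x) ⟩
    ∼ x                     ∎

  ∼-⊔-∼∼ʳ : ∀ p q → ∼ (p ⊔K ∼ ∼ q) ≈ ∼ (p ⊔K q)
  ∼-⊔-∼∼ʳ p q = begin-equality
    ∼ (p ⊔K ∼ ∼ q)              ≈⟨ ∼-⊔-∼∼ p (∼ ∼ q) ⟨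
    ∼ (∼ ∼ p ⊔K ∼ ∼ ∼ ∼ q)      ≈⟨ ∼-cong (⊔-cong Eq.refl (∼-cong (∼∼∼ q))) ⟩
    ∼ (∼ ∼ p ⊔K ∼ ∼ q)          ≈⟨ ∼-⊔-∼∼ p q ⟩
    ∼ (p ⊔K q)                  ∎

  ∼-⊔-∼∼ˡ : ∀ p q → ∼ (∼ ∼ p ⊔K q) ≈ ∼ (p ⊔K q)
  ∼-⊔-∼∼ˡ p q = begin-equality
    ∼ (∼ ∼ p ⊔K q)              ≈⟨ ∼-⊔-∼∼ (∼ ∼ p) q ⟨
    ∼ (∼ ∼ ∼ ∼ p ⊔K ∼ ∼ q)      ≈⟨ ∼-cong (⊔-cong (∼-cong (∼∼∼ p)) Eq.refl) ⟩
    ∼ (∼ ∼ p ⊔K ∼ ∼ q)          ≈⟨ ∼-⊔-∼∼ p q ⟩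
    ∼ (p ⊔K q)                  ∎

  ∼∼-test : ∀ (w : Test) → ∼ ∼ proj₁ w ≈ proj₁ w
  ∼∼-test (w , k , w≈∼k) = begin-equality
    ∼ ∼ w       ≈⟨ ∼-cong (∼-cong w≈∼k) ⟩
    ∼ ∼ ∼ k     ≈⟨ ∼∼∼ k ⟩
    ∼ k         ≈⟨ w≈∼k ⟨
    w           ∎

  _∨ₜ_ : Test → Test → Test
  a ∨ₜ b = ∼ ∼ (proj₁ a ⊔K proj₁ b) , ∼ (proj₁ a ⊔K proj₁ b) , Eq.refl

  ∨ₜ-upperˡ : ∀ a b → a ⪯ (a ∨ₜ b)
  ∨ₜ-upperˡ (a , _) (b , _) = ∼-cong (Eq.trans (∼-⊔-∼∼ʳ a (a ⊔K b)) (∼-cong (x≤y⇒x⊔y≈y (⊔-upperˡ a b))))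

  ∨ₜ-upperʳ : ∀ a b → b ⪯ (a ∨ₜ b)
  ∨ₜ-upperʳ (a , _) (b , _) = ∼-cong (Eq.trans (∼-⊔-∼∼ʳ b (a ⊔K b)) (∼-cong (x≤y⇒x⊔y≈y (⊔-upperʳ a b))))

  ∨ₜ-least : ∀ a b m → a ⪯ m → b ⪯ m → (a ∨ₜ b) ⪯ m
  ∨ₜ-least (a , _) (b , _) (m , _) a⪯m b⪯m = begin-equality
    ∼ ∼ (∼ ∼ (a ⊔K b) ⊔K m)     ≈⟨ ∼-cong (∼-⊔-∼∼ˡ (a ⊔K b) m) ⟩
    ∼ ∼ (a ⊔K b ⊔K m)           ≈⟨ ∼-cong (∼-cong (⊔-assoc a b m)) ⟩
    ∼ ∼ (a ⊔K (b ⊔K m))         ≈⟨ ∼-cong (∼-⊔-∼∼ʳ a (b ⊔K m)) ⟨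
    ∼ ∼ (a ⊔K ∼ ∼ (b ⊔K m))     ≈⟨ ∼-cong (∼-cong (⊔-cong Eq.refl b⪯m)) ⟩
    ∼ ∼ (a ⊔K m)                ≈⟨ a⪯m ⟩
    m                           ∎

  e*≈e : e * ≈ e
  e*≈e = begin-equality
    e *             ≈⟨ ⊙-identityˡ (e *) ⟨
    e ⊙ e *         ≈⟨ ⊙-cong (*-involutive e) Eq.refl ⟨
    e * * ⊙ e *     ≈⟨ *-antihom e (e *) ⟨
    (e ⊙ e *) *     ≈⟨ *-cong (⊙-identityˡ (e *)) ⟩
    e * *           ≈⟨ *-involutive e ⟩
    e               ∎

  _•ₜ_ : Carrier → Test → Test
  s •ₜ x = s • x , ∼ (s ⊙ proj₁ x) , Eq.refl

  •ₜ-congˡ : ∀ {s s'} → s ≈ s' → ∀ x → (s •ₜ x) ≈ₜ (s' •ₜ x)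
  •ₜ-congˡ s≈s' x = ∼-cong (∼-cong (⊙-cong s≈s' Eq.refl))

  e-•ₜ : ∀ x → (e •ₜ x) ≈ₜ x
  e-•ₜ x = Eq.trans (∼-cong (∼-cong (⊙-identityˡ (proj₁ x)))) (∼∼-test x)

  ⊙-•ₜ : ∀ s t x → ((s ⊙ t) •ₜ x) ≈ₜ (s •ₜ (t •ₜ x))
  ⊙-•ₜ s t (x , _) = begin-equality
    ∼ ∼ (s ⊙ t ⊙ x)              ≈⟨ ∼-cong (∼-cong (⊙-assoc s t x)) ⟩
    ∼ ∼ (s ⊙ (t ⊙ x))            ≈⟨ ∼-cong (∼-⊙ s (t ⊙ x)) ⟨
    ∼ ∼ (s ⊙ ∼ ∼ (t ⊙ x))        ∎

module SasakiRepresentation {c ℓ ι} (K : IDA c ℓ ι) (SF : IsSemiFoulis K) where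
  open IDA K
  open IDAProperties K
  open PosetReasoning poset

  𝕄 : CompleteOML (c ⊔ ℓ) ℓ ℓ ι
  𝕄 = testOML K SF

  private
    module T = CompleteOML 𝕄
    module O = OMLProperties 𝕄
  open LinOf 𝕄

  ∨≈∨ₜ : ∀ a b → (a T.∨ b) ≈ₜ (a ∨ₜ b)
  ∨≈∨ₜ a b = O.antisym {a T.∨ b} {a ∨ₜ b}
    (T.∨-least a b (a ∨ₜ b) (∨ₜ-upperˡ a b) (∨ₜ-upperʳ a b))
    (∨ₜ-least a b (a T.∨ b) (T.∨-upperˡ a b) (T.∨-upperʳ a b))

  ∼-⊔≈⊥-∨ : ∀ a b → ∼ (proj₁ a ⊔K proj₁ b) ≈ proj₁ ((a T.∨ b) ⊥ₜ)
  ∼-⊔≈⊥-∨ a b = Eq.trans (Eq.sym (∼∼∼ _)) (∼-cong (Eq.sym (∨≈∨ₜ a b)))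

  •ₜ≈π : ∀ w x → (proj₁ w •ₜ x) ≈ₜ π w x
  •ₜ≈π w x = begin-equality
    ∼ ∼ (proj₁ w ⊙ proj₁ x)                        ≈⟨ ∼-cong (∼-cong (⊙-cong (∼∼-test w) Eq.refl)) ⟨
    ∼ ∼ (∼ ∼ proj₁ w ⊙ proj₁ x)                    ≈⟨ ∼-ax4 (proj₁ w) (proj₁ x) ⟩
    ∼ (∼ proj₁ w ⊔K ∼ (∼ proj₁ w ⊔K proj₁ x))      ≈⟨ ∼-cong (⊔-cong Eq.refl (∼-⊔≈⊥-∨ (w ⊥ₜ) x)) ⟩
    ∼ (∼ proj₁ w ⊔K proj₁ (((w ⊥ₜ) T.∨ x) ⊥ₜ))     ≈⟨ ∼-⊔≈⊥-∨ (w ⊥ₜ) (((w ⊥ₜ) T.∨ x) ⊥ₜ) ⟩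
    proj₁ (((w ⊥ₜ) T.∨ (((w ⊥ₜ) T.∨ x) ⊥ₜ)) ⊥ₜ)   ≈⟨ O.∧≈ᶜ∨ᶜ w ((w ⊥ₜ) T.∨ x) ⟨
    proj₁ (π w x)                                  ∎

  record _Represents_ (f : Test → Test) (s : Carrier) : Set (c ⊔ ℓ) where
    constructor mkRepresents
    field
      ≈• : ∀ x → f x ≈ₜ (s •ₜ x)
  open _Represents_

  represents-unique : ∀ {f g s} → f Represents s → g Represents s → ∀ x → f x ≈ₜ g x
  represents-unique f~s g~s x = Eq.trans (≈• f~s x) (Eq.sym (≈• g~s x))

  represents-resp : ∀ {f s s'} → s ≈ s' → f Represents s → f Represents s'
  represents-resp s≈s' f~s = mkRepresents λ x → Eq.trans (≈• f~s x) (•ₜ-congˡ s≈s' x)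

  represents-π : ∀ w → π w Represents proj₁ w
  represents-π w = mkRepresents λ x → Eq.sym (•ₜ≈π w x)

  represents-id : (λ x → x) Represents e
  represents-id = mkRepresents λ x → Eq.sym (e-•ₜ x)

  represents-∘ : ∀ F {g s t} → fun F Represents s → g Represents t → (λ x → fun F (g x)) Represents (s ⊙ t)
  represents-∘ F {g} {s} {t} F~s g~t = mkRepresents λ x → begin-equality
    proj₁ (fun F (g x))         ≈⟨ O.fun-cong F (≈• g~t x) ⟩
    proj₁ (fun F (t •ₜ x))      ≈⟨ ≈• F~s (t •ₜ x) ⟩
    proj₁ (s •ₜ (t •ₜ x))       ≈⟨ ⊙-•ₜ s t x ⟨
    proj₁ ((s ⊙ t) •ₜ x)        ∎

  Representation : Carrier → Set (c ⊔ ℓ)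
  Representation s = Σ (𝒯Elem LinSig) λ F → (fun (proj₁ F) Represents s) × (adj (proj₁ F) Represents (s *))

  represent : ∀ {s} → 𝒯 sig s → Representation s
  represent (𝒯-test k) = (πL w , O.πL∈𝒯 w) , represents-π w , represents-resp (Eq.sym (∼-* k)) (represents-π w)
    where
      w : Test
      w = ∼ k , k , Eq.refl
  represent 𝒯-e = (idL , 𝒯-e) , represents-id , represents-resp (Eq.sym e*≈e) represents-id
  represent (𝒯-⊙ {s} {t} p q) with represent p | represent q
  ... | F , F~s , F*~s* | G , G~t , G*~t* =
    (proj₁ F ∘L proj₁ G , 𝒯-⊙ (proj₂ F) (proj₂ G)) ,
    represents-∘ (proj₁ F) F~s G~t ,
    represents-resp (Eq.sym (*-antihom s t)) (represents-∘ (proj₁ G *L) G*~t* F*~s*)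
  represent (𝒯-* {s} p) with represent p
  ... | F , F~s , F*~s* =
    (proj₁ F *L , 𝒯-* (proj₂ F)) , F*~s* , represents-resp (Eq.sym (*-involutive s)) F~s
  represent (𝒯-resp s≈s' p) with represent p
  ... | F , F~s , F*~s* = F , represents-resp s≈s' F~s , represents-resp (*-cong s≈s') F*~s*

  ν : 𝒯Elem sig → 𝒯Elem LinSig
  ν (_ , s∈𝒯) = proj₁ (represent s∈𝒯)

  ν-represents : ∀ a → fun (proj₁ (ν a)) Represents proj₁ a
  ν-represents (_ , s∈𝒯) = proj₁ (proj₂ (represent s∈𝒯))

  ν-represents-* : ∀ a → adj (proj₁ (ν a)) Represents (proj₁ a *)
  ν-represents-* (_ , s∈𝒯) = proj₂ (proj₂ (represent s∈𝒯))

  ν-isHom : IsInvMonoidHom sig LinSig ν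
  ν-isHom = record
    { φ-cong = λ a b a≈b → represents-unique (ν-represents a) (represents-resp (Eq.sym a≈b) (ν-represents b))
    ; φ-e = λ p → represents-unique (ν-represents (e , p)) represents-id
    ; φ-⊙ = λ a b p → represents-unique (ν-represents (_ , p)) (represents-∘ (proj₁ (ν a)) (ν-represents a) (ν-represents b))
    ; φ-* = λ a p → represents-unique (ν-represents (_ , p)) (ν-represents-* a) }

  ν-test : ∀ w → proj₁ (ν (testElem w)) ≈L πL w
  ν-test w = represents-unique (ν-represents (testElem w)) (represents-π w)

  ν-test-mono : ∀ w w' → w ⪯ w' →
    proj₁ (ν (testElem w)) ≈L (proj₁ (ν (testElem w')) ∘L proj₁ (ν (testElem w)))
  ν-test-mono w w' w⪯w' x = begin-equality
    proj₁ (fun νw x)              ≈⟨ ν-test w x ⟩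
    proj₁ (π w x)                 ≈⟨ O.πL-absorbs-below {w} {w'} w⪯w' x ⟨
    proj₁ (π w' (π w x))          ≈⟨ ν-test w' (π w x) ⟨
    proj₁ (fun νw' (π w x))       ≈⟨ O.fun-cong νw' (ν-test w x) ⟨
    proj₁ (fun νw' (fun νw x))    ∎
    where
      νw νw' : LinMap
      νw = proj₁ (ν (testElem w))
      νw' = proj₁ (ν (testElem w'))

  sasakiRepresentation : Separated K → Part2 K SF
  sasakiRepresentation separated = record
    { ν = ν
    ; ν-def = λ a → ≈• (ν-represents a)
    ; ν-iso = record
      { isHom = ν-isHom
      ; injective = λ a b νa≈νb → Equivalence.from (separated _ _ (proj₂ a) (proj₂ b))
          (λ w → Eq.trans (Eq.sym (≈• (ν-represents a) w)) (Eq.trans (νa≈νb w) (≈• (ν-represents b) w)))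
      ; surjective = hitsTests⇒surjective O.linCongruence ν-isHom
          (λ f → testElem (fun f T.𝟙 ⊥ₜ) , ν-test (fun f T.𝟙 ⊥ₜ)) }
    ; ν-test-into = λ w → w , ν-test w
    ; ν-test-onto = λ u → u , ν-test u
    ; ν-test-mono = ν-test-mono }

proposition4p9 : ∀ {c ℓ ι c₁ ℓ₁ c₂ ℓ₂ d m₁ m₂ : Level} →
    ((K : IDA c ℓ ι) → Part1 K) ×
    ((K : IDA c ℓ ι) (SF : IsSemiFoulis K) → Separated K → Part2 K SF) ×
    ((M : CompleteOML d m₁ m₂ (d ⊔ m₁ ⊔ m₂)) → Part3 M) ×
    ({K₁ : IDA c₁ ℓ₁ ι} {K₂ : IDA c₂ ℓ₂ ι} (f : IDAMorphism K₁ K₂) → Part4 f)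
proposition4p9 =
  𝒯-isInvolutiveSubmonoid ,
  (λ K SF → SasakiRepresentation.sasakiRepresentation K SF) ,
  (λ M → SingletonEmbedding.singletonEmbedding M) ,
  𝒯-restrictsMorphism
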